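{- Let $k$ be a positive integer and $n\geq 16k$. Then there exists an odd-colorable $4k$-graph of order $n$ with chromatic number exactly $3$.
   Context: An $r$-graph $G$ consists of a vertex set $V(G)$ and a set $E(G)$ of $r$-element subsets of $V(G)$ (edges); its order is $|V(G)|$. An $r$-graph $G$ (with $r$ even) is odd-colorable if there is a map $\varphi:V(G)\to[r]$ such that for every edge $\{i_1,\ldots,i_r\}$, $\varphi(i_1)+\cdots+\varphi(i_r)\equiv r/2\pmod r$. $G$ is $m$-chromatic if $V(G)$ can be partitioned into $m$ sets so that each edge intersects at least two of the sets; the chromatic number $\chi(G)$ is the smallest such $m$. -}

module Defs where

open import Data.Nat using (ℕ; suc; _+_; _*_; _<_)
open import Data.Nat.DivMod using (_/_)
open import Data.Fin using (Fin; toℕ)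
open import Data.Fin.Subset using (Subset; _∈_; ∣_∣)
open import Data.Bool using (if_then_else_)
open import Data.Vec using (lookup)
open import Data.List using (List; map; allFin)
open import Data.Nat.ListAction using (sum)
open import Data.List.Relation.Unary.All using (All)
open import Data.List.Membership.Propositional renaming (_∈_ to _∈ₗ_)
open import Data.Product using (Σ; ∃; _×_)
open import Relation.Nullary using (¬_)
open import Relation.Binary.PropositionalEquality using (_≡_; _≢_)

record Hypergraph (r n : ℕ) : Set where
  field
    edges   : List (Subset n)
    uniform : All (λ e → ∣ e ∣ ≡ r) edges
open Hypergraph public

-- Colours are [r] = {1,…,r}; colour c : Fin r stands for the integer toℕ c + 1.
colourValue : {r : ℕ} → Fin r → ℕ
colourValue c = suc (toℕ c)

edgeSum : {n r : ℕ} → (Fin n → Fin r) → Subset n → ℕ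
edgeSum {n} φ e = sum (map (λ i → if lookup e i then colourValue (φ i) else 0) (allFin n))

-- a ≡ b (mod r), written out as: a = q * r + b for some q
-- (used with b = r/2 < r, so this is exactly a mod r = r/2)
-- odd-colorable: φ(i₁)+⋯+φ(i_r) ≡ r/2 (mod r) on every edge
OddColorable : {r n : ℕ} → Hypergraph r n → Set
OddColorable {r} {n} G =
  ∃ λ (φ : Fin n → Fin r) →
    ∀ e → e ∈ₗ edges G → ∃ λ (q : ℕ) → edgeSum φ e ≡ q * r + r / 2

-- m-chromatic: a partition of V(G) into m (labelled, possibly empty) classes
-- such that every edge meets at least two classes.
Chromatic : {r n : ℕ} → Hypergraph r n → ℕ → Set
Chromatic {r} {n} G m =
  ∃ λ (c : Fin n → Fin m) →
    ∀ e → e ∈ₗ edges G →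
      ∃ λ (i : Fin n) → ∃ λ (j : Fin n) → i ∈ e × j ∈ e × c i ≢ c j

ChromaticNumber : {r n : ℕ} → Hypergraph r n → ℕ → Set
ChromaticNumber G m = Chromatic G m × (∀ m' → m' < m → ¬ Chromatic G m')

module Submission where

-- Split the vertex set into blocks Y, Z, X with |Y| = |Z| = 4k, |X| = n - 8k ≥ 8k,
-- and take as edges ALL sets meeting (Y, Z, X) in (2k,0,2k), (2k,2k,0) or (0,k,3k)
-- vertices.  Colouring Y, Z, X with the values 1, 2, 4k gives the edge sums
-- 2k + 8k², 6k, 2k + 12k², all ≡ 2k = 4k/2 (mod 4k).  Every profile meets two
-- blocks, so colouring the blocks 0, 1, 2 is proper.  In a 2-colouring the
-- majority colour of a block covers half of it (2k vertices of Y and Z, 3k of X);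
-- two of the three majority colours agree, and the matching profile then fits in
-- one colour class: a monochromatic edge.

open import Defs
open import Function using (_∘_)
open import Data.Nat using (ℕ; zero; suc; _+_; _*_; _∸_; _≤_; _<_; z≤n; s≤s; s≤s⁻¹)
open import Data.Nat.Properties
open import Data.Nat.DivMod using (_/_; m*n/n≡m)
open import Data.Nat.Tactic.RingSolver using (solve-∀)
open import Data.Nat.ListAction using (sum)
open import Data.Bool using (Bool; true; false; if_then_else_)
open import Data.Product using (Σ; ∃; _×_; _,_)
open import Data.Sum using (_⊎_; inj₁; inj₂)
open import Data.Empty using (⊥-elim) renaming (⊥ to False)
open import Relation.Nullary using (¬_; yes; no)
open import Relation.Binary.PropositionalEquality using (_≡_; _≢_; refl; sym; trans; cong; cong₂; subst; module ≡-Reasoning)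
open import Data.Fin using (Fin; zero; suc; fromℕ; fromℕ<; _↑ˡ_; _↑ʳ_; inject≤)
open import Data.Fin.Properties using (toℕ-fromℕ; toℕ-fromℕ<; inject≤-injective)
open import Data.Fin.Subset using (Subset; inside; outside; _∈_; _⊆_; ∣_∣; ∁; Nonempty)
  renaming (⊥ to ∅)
open import Data.Fin.Subset.Properties using (s⊆s; ⊥⊆; ∉⊥; ∣⊥∣≡0; ∣∁p∣≡n∸∣p∣; x∈∁p⇒x∉p)
open import Data.Vec using ([]; _∷_; _++_; lookup; here; there)
import Data.Vec as Vec
open import Data.Vec.Properties using ([]=⇒lookup; lookup⇒[]=; lookup∘tabulate)
import Data.Vec.Functional as Fun
open import Data.Vec.Functional.Properties using (lookup-++ˡ; lookup-++ʳ)
open import Data.List using (List; [_]; map; tabulate; concatMap; cartesianProductWith)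
  renaming ([] to []ₗ; _∷_ to _∷ₗ_; _++_ to _++ₗ_)
open import Data.List.Properties using (map-tabulate)
open import Data.List.Relation.Unary.All as All using (All)
import Data.List.Relation.Unary.Any as Any
open import Data.List.Membership.Propositional using (find) renaming (_∈_ to _∈ₗ_)
open import Data.List.Membership.Propositional.Properties
  using (∈-++⁺ˡ; ∈-++⁺ʳ; ∈-++⁻; ∈-map⁺; ∈-map⁻; ∈-concatMap⁺; ∈-concatMap⁻;
         ∈-cartesianProductWith⁺; ∈-cartesianProductWith⁻)

∣++∣ : {m n : ℕ} (u : Subset m) (v : Subset n) → ∣ u ++ v ∣ ≡ ∣ u ∣ + ∣ v ∣
∣++∣ []            v = refl
∣++∣ (inside  ∷ u) v = cong suc (∣++∣ u v)
∣++∣ (outside ∷ u) v = ∣++∣ u v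

∈-↑ˡ : {m n : ℕ} {u : Subset m} (v : Subset n) {i : Fin m} → i ∈ u → (i ↑ˡ n) ∈ u ++ v
∈-↑ˡ v here      = here
∈-↑ˡ v (there p) = there (∈-↑ˡ v p)

∈-↑ʳ : {m n : ℕ} (u : Subset m) {v : Subset n} {i : Fin n} → i ∈ v → (m ↑ʳ i) ∈ u ++ v
∈-↑ʳ []      p = p
∈-↑ʳ (_ ∷ u) p = there (∈-↑ʳ u p)

nonempty : {n : ℕ} (u : Subset n) → 0 < ∣ u ∣ → Nonempty u
nonempty (inside  ∷ u) _ = zero , here
nonempty (outside ∷ u) pos with nonempty u pos
... | i , i∈u = suc i , there i∈u

subsetOfSize : {n : ℕ} (s : ℕ) (u : Subset n) → s ≤ ∣ u ∣ → ∃ λ u′ → u′ ⊆ u × ∣ u′ ∣ ≡ s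
subsetOfSize {n} zero u _ = ∅ , ⊥⊆ , ∣⊥∣≡0 n
subsetOfSize (suc s) (inside ∷ u) (s≤s s≤∣u∣) with subsetOfSize s u s≤∣u∣
... | u′ , u′⊆u , refl = inside ∷ u′ , s⊆s u′⊆u , refl
subsetOfSize (suc s) (outside ∷ u) s<∣u∣ with subsetOfSize (suc s) u s<∣u∣
... | u′ , u′⊆u , ∣u′∣≡s = outside ∷ u′ , s⊆s u′⊆u , ∣u′∣≡s

subsetsOfSize : (n s : ℕ) → List (Subset n)
subsetsOfSize zero    zero    = [ [] ]
subsetsOfSize zero    (suc s) = []ₗ
subsetsOfSize (suc n) zero    = map (outside ∷_) (subsetsOfSize n zero)
subsetsOfSize (suc n) (suc s) =
  map (inside ∷_) (subsetsOfSize n s) ++ₗ map (outside ∷_) (subsetsOfSize n (suc s))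

∈-subsetsOfSize-outside : {n s : ℕ} {u : Subset n} →
  u ∈ₗ subsetsOfSize n s → outside ∷ u ∈ₗ subsetsOfSize (suc n) s
∈-subsetsOfSize-outside {s = zero}  p = ∈-map⁺ (outside ∷_) p
∈-subsetsOfSize-outside {n} {suc s} p =
  ∈-++⁺ʳ (map (inside ∷_) (subsetsOfSize n s)) (∈-map⁺ (outside ∷_) p)

subsetsOfSize-complete : {n : ℕ} (u : Subset n) → u ∈ₗ subsetsOfSize n ∣ u ∣
subsetsOfSize-complete []            = Any.here refl
subsetsOfSize-complete (inside  ∷ u) = ∈-++⁺ˡ (∈-map⁺ (inside ∷_) (subsetsOfSize-complete u))
subsetsOfSize-complete (outside ∷ u) = ∈-subsetsOfSize-outside (subsetsOfSize-complete u)

subsetsOfSize-sound : (n s : ℕ) {u : Subset n} → u ∈ₗ subsetsOfSize n s → ∣ u ∣ ≡ s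
subsetsOfSize-sound zero    zero    (Any.here refl) = refl
subsetsOfSize-sound (suc n) zero    p with ∈-map⁻ (outside ∷_) p
... | _ , q , refl = subsetsOfSize-sound n zero q
subsetsOfSize-sound (suc n) (suc s) p with ∈-++⁻ (map (inside ∷_) (subsetsOfSize n s)) p
... | inj₁ q with ∈-map⁻ (inside ∷_) q
...   | _ , r , refl = cong suc (subsetsOfSize-sound n s r)
subsetsOfSize-sound (suc n) (suc s) p | inj₂ q with ∈-map⁻ (outside ∷_) q
...   | _ , r , refl = subsetsOfSize-sound n (suc s) r

weight : {n : ℕ} → (Fin n → ℕ) → Subset n → ℕ
weight w []      = 0
weight w (b ∷ e) = (if b then w zero else 0) + weight (w ∘ suc) e

weight-tabulate : {n : ℕ} (w : Fin n → ℕ) (e : Subset n) →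
  sum (tabulate (λ i → if lookup e i then w i else 0)) ≡ weight w e
weight-tabulate w []      = refl
weight-tabulate w (b ∷ e) = cong ((if b then w zero else 0) +_) (weight-tabulate (w ∘ suc) e)

edgeSum≡weight : {n r : ℕ} (φ : Fin n → Fin r) (e : Subset n) →
  edgeSum φ e ≡ weight (colourValue ∘ φ) e
edgeSum≡weight φ e =
  trans (cong sum (map-tabulate (λ i → i) (λ i → if lookup e i then colourValue (φ i) else 0)))
        (weight-tabulate (colourValue ∘ φ) e)

weight-++ : {m n : ℕ} (w : Fin (m + n) → ℕ) (u : Subset m) (v : Subset n) →
  weight w (u ++ v) ≡ weight (w ∘ (_↑ˡ n)) u + weight (w ∘ (m ↑ʳ_)) v
weight-++ w []      v = refl
weight-++ w (b ∷ u) v =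
  trans (cong ((if b then w zero else 0) +_) (weight-++ (w ∘ suc) u v))
        (sym (+-assoc (if b then w zero else 0) _ _))

weight-constant : {n : ℕ} (w : Fin n → ℕ) (x : ℕ) → (∀ i → w i ≡ x) →
  (e : Subset n) → weight w e ≡ x * ∣ e ∣
weight-constant w x w≡x []            = sym (*-zeroʳ x)
weight-constant w x w≡x (outside ∷ e) = weight-constant (w ∘ suc) x (w≡x ∘ suc) e
weight-constant w x w≡x (inside  ∷ e) =
  trans (cong₂ _+_ (w≡x zero) (weight-constant (w ∘ suc) x (w≡x ∘ suc) e)) (sym (*-suc x ∣ e ∣))

Proper : {r n m : ℕ} → Hypergraph r n → (Fin n → Fin m) → Set
Proper {n = n} G c =
  ∀ e → e ∈ₗ edges G → ∃ λ (i : Fin n) → ∃ λ (j : Fin n) → i ∈ e × j ∈ e × c i ≢ c j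

Monochromatic : {n m : ℕ} → (Fin n → Fin m) → Fin m → Subset n → Set
Monochromatic c col u = ∀ {i} → i ∈ u → c i ≡ col

mono-++ : {m n k : ℕ} (c : Fin (m + n) → Fin k) {col : Fin k} (u : Subset m) {v : Subset n} →
  Monochromatic (c ∘ (_↑ˡ n)) col u → Monochromatic (c ∘ (m ↑ʳ_)) col v →
  Monochromatic c col (u ++ v)
mono-++ c []      mu mv i∈v       = mv i∈v
mono-++ c (_ ∷ u) mu mv here      = mu here
mono-++ c (_ ∷ u) mu mv (there p) = mono-++ (c ∘ suc) u (mu ∘ there) mv p

proper⇒¬mono-edge : {r n m : ℕ} {G : Hypergraph r n} {c : Fin n → Fin m} {col : Fin m} →
  Proper G c → {e : Subset n} → e ∈ₗ edges G → ¬ Monochromatic c col e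
proper⇒¬mono-edge proper e∈G mono with proper _ e∈G
... | i , j , i∈e , j∈e , ci≢cj = ci≢cj (trans (mono i∈e) (sym (mono j∈e)))

chromatic-weaken : {r n m m′ : ℕ} {G : Hypergraph r n} → m ≤ m′ → Chromatic G m → Chromatic G m′
chromatic-weaken {n = n} {m′ = m′} {G} m≤m′ (c , proper) = c′ , proper′
  where
  c′ : Fin n → Fin m′
  c′ i = inject≤ (c i) m≤m′
  proper′ : Proper G c′
  proper′ e e∈G with proper e e∈G
  ... | i , j , i∈e , j∈e , ci≢cj = i , j , i∈e , j∈e , ci≢cj ∘ inject≤-injective m≤m′ m≤m′ (c i) (c j)

-- By monotonicity, χ(G) = m + 1 as soon as G is (m + 1)- but not m-chromatic.
chromaticNumber-intro : {r n m : ℕ} {G : Hypergraph r n} →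
  Chromatic G (suc m) → ¬ Chromatic G m → ChromaticNumber G (suc m)
chromaticNumber-intro {G = G} χ≤ ¬χ≤ = χ≤ , λ m′ m′≤m χ′ → ¬χ≤ (chromatic-weaken {G = G} (s≤s⁻¹ m′≤m) χ′)

-- Majority lemma for 2-colourings

LargeMono : {n m : ℕ} → (Fin n → Fin m) → Fin m → ℕ → Set
LargeMono c col t = ∃ λ u → t ≤ ∣ u ∣ × Monochromatic c col u

largeMono-zero : {n m : ℕ} (c : Fin n → Fin m) (col : Fin m) → LargeMono c col 0
largeMono-zero c col = ∅ , z≤n , λ i∈∅ → ⊥-elim (∉⊥ i∈∅)

largeMono-weaken : {n m s t : ℕ} {c : Fin n → Fin m} {col : Fin m} →
  s ≤ t → LargeMono c col t → LargeMono c col s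
largeMono-weaken s≤t (u , t≤∣u∣ , mu) = u , ≤-trans s≤t t≤∣u∣ , mu

largeMono-exact : {n m t : ℕ} {c : Fin n → Fin m} {col : Fin m} →
  LargeMono c col t → ∃ λ u → ∣ u ∣ ≡ t × Monochromatic c col u
largeMono-exact {t = t} (u , t≤∣u∣ , mu) with subsetOfSize t u t≤∣u∣
... | u′ , u′⊆u , ∣u′∣≡t = u′ , ∣u′∣≡t , mu ∘ u′⊆u

isZero : Fin 2 → Bool
isZero zero    = true
isZero (suc _) = false

zeroClass : {n : ℕ} → (Fin n → Fin 2) → Subset n
zeroClass c = Vec.tabulate (isZero ∘ c)

zeroClass-mono : {n : ℕ} (c : Fin n → Fin 2) → Monochromatic c zero (zeroClass c)
zeroClass-mono c {i} i∈ = isZero⇒zero (c i) (trans (sym (lookup∘tabulate (isZero ∘ c) i)) ([]=⇒lookup i∈))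
  where
  isZero⇒zero : (x : Fin 2) → isZero x ≡ true → x ≡ zero
  isZero⇒zero zero _ = refl

zeroClass-complement-mono : {n : ℕ} (c : Fin n → Fin 2) → Monochromatic c (suc zero) (∁ (zeroClass c))
zeroClass-complement-mono c {i} i∈∁ = notZero (c i) λ isZ →
  x∈∁p⇒x∉p i∈∁ (lookup⇒[]= i _ (trans (lookup∘tabulate (isZero ∘ c) i) isZ))
  where
  notZero : (x : Fin 2) → ¬ isZero x ≡ true → x ≡ suc zero
  notZero zero       ¬isZ = ⊥-elim (¬isZ refl)
  notZero (suc zero) _    = refl

half-or-rest : {n t : ℕ} → t + t ≤ suc n → (a : ℕ) → t ≤ a ⊎ t ≤ n ∸ a
half-or-rest {n} {t} 2t≤n+1 a with t ≤? a
... | yes t≤a = inj₁ t≤a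
... | no  t≰a = inj₂ (m+n≤o⇒m≤o∸n t (s≤s⁻¹ (begin
    suc (t + a) ≡⟨ sym (+-suc t a) ⟩
    t + suc a   ≤⟨ +-monoʳ-≤ t (≰⇒> t≰a) ⟩
    t + t       ≤⟨ 2t≤n+1 ⟩
    suc n       ∎)))
  where open ≤-Reasoning

majority : {n t : ℕ} (c : Fin n → Fin 2) → t + t ≤ suc n → ∃ λ col → LargeMono c col t
majority {t = t} c 2t≤n+1 with half-or-rest 2t≤n+1 ∣ zeroClass c ∣
... | inj₁ t≤∣Z∣  = zero , zeroClass c , t≤∣Z∣ , zeroClass-mono c
... | inj₂ t≤n∸∣Z∣ = suc zero , ∁ (zeroClass c) ,
  subst (t ≤_) (sym (∣∁p∣≡n∸∣p∣ (zeroClass c))) t≤n∸∣Z∣ , zeroClass-complement-mono c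

pigeonhole : (a b c : Fin 2) → a ≡ b ⊎ a ≡ c ⊎ b ≡ c
pigeonhole zero       zero       _          = inj₁ refl
pigeonhole (suc zero) (suc zero) _          = inj₁ refl
pigeonhole zero       (suc zero) zero       = inj₂ (inj₁ refl)
pigeonhole zero       (suc zero) (suc zero) = inj₂ (inj₂ refl)
pigeonhole (suc zero) zero       zero       = inj₂ (inj₂ refl)
pigeonhole (suc zero) zero       (suc zero) = inj₂ (inj₁ refl)

-- Hypergraphs on three blocks defined by intersection profiles

-- The sizes (x , y , z) of the intersections of an edge with the three blocks.
Profile : Set
Profile = ℕ × ℕ × ℕ

Sized : ℕ → Profile → Set
Sized r (x , y , z) = x + (y + z) ≡ r

Spread : Profile → Set
Spread (x , y , z) = (0 < x × 0 < y) ⊎ (0 < x × 0 < z) ⊎ (0 < y × 0 < z)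

OddProfile : {r : ℕ} → Fin r → Fin r → Fin r → Profile → Set
OddProfile {r} α β γ (x , y , z) =
  ∃ λ q → colourValue α * x + (colourValue β * y + colourValue γ * z) ≡ q * r + r / 2

-- Vertex set V = Fin (n₁ + (n₂ + n₃)), a disjoint union of three blocks; a subset
-- of V is u ++ (v ++ w) with u, v, w its parts in the blocks.
module ThreeBlocks (n₁ n₂ n₃ : ℕ) where

  V : ℕ
  V = n₁ + (n₂ + n₃)

  ι₁ : Fin n₁ → Fin V
  ι₁ i = i ↑ˡ (n₂ + n₃)

  ι₂ : Fin n₂ → Fin V
  ι₂ i = n₁ ↑ʳ (i ↑ˡ n₃)

  ι₃ : Fin n₃ → Fin V
  ι₃ i = n₁ ↑ʳ (n₂ ↑ʳ i)

  Realises : Profile → Subset V → Set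
  Realises (x , y , z) e = ∃ λ (u : Subset n₁) → ∃ λ (v : Subset n₂) → ∃ λ (w : Subset n₃) →
    e ≡ u ++ (v ++ w) × ∣ u ∣ ≡ x × ∣ v ∣ ≡ y × ∣ w ∣ ≡ z

  layer : Profile → List (Subset V)
  layer (x , y , z) = cartesianProductWith _++_ (subsetsOfSize n₁ x)
    (cartesianProductWith _++_ (subsetsOfSize n₂ y) (subsetsOfSize n₃ z))

  layer-sound : (p : Profile) {e : Subset V} → e ∈ₗ layer p → Realises p e
  layer-sound (x , y , z) e∈ with ∈-cartesianProductWith⁻ _++_ (subsetsOfSize n₁ x) _ e∈
  ... | u , vw , u∈ , vw∈ , refl with ∈-cartesianProductWith⁻ _++_ (subsetsOfSize n₂ y) _ vw∈
  ...   | v , w , v∈ , w∈ , refl =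
    u , v , w , refl , subsetsOfSize-sound n₁ x u∈ , subsetsOfSize-sound n₂ y v∈ , subsetsOfSize-sound n₃ z w∈

  layer-complete : (u : Subset n₁) (v : Subset n₂) (w : Subset n₃) →
    u ++ (v ++ w) ∈ₗ layer (∣ u ∣ , ∣ v ∣ , ∣ w ∣)
  layer-complete u v w = ∈-cartesianProductWith⁺ _++_ (subsetsOfSize-complete u)
    (∈-cartesianProductWith⁺ _++_ (subsetsOfSize-complete v) (subsetsOfSize-complete w))

  blockEdges : List Profile → List (Subset V)
  blockEdges = concatMap layer

  blockEdge-sound : {ps : List Profile} {e : Subset V} → e ∈ₗ blockEdges ps →
    ∃ λ p → p ∈ₗ ps × Realises p e
  blockEdge-sound e∈ with find (∈-concatMap⁻ layer e∈)
  ... | p , p∈ , e∈layer = p , p∈ , layer-sound p e∈layer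

  blockEdge-complete : {ps : List Profile} {x y z : ℕ} → (x , y , z) ∈ₗ ps →
    {u : Subset n₁} {v : Subset n₂} {w : Subset n₃} →
    ∣ u ∣ ≡ x → ∣ v ∣ ≡ y → ∣ w ∣ ≡ z → u ++ (v ++ w) ∈ₗ blockEdges ps
  blockEdge-complete p∈ {u} {v} {w} refl refl refl =
    ∈-concatMap⁺ layer (Any.map (λ { refl → layer-complete u v w }) p∈)

  blockHypergraph : (r : ℕ) (ps : List Profile) → All (Sized r) ps → Hypergraph r V
  blockHypergraph r ps sized = record { edges = blockEdges ps ; uniform = All.tabulate size }
    where
    size : {e : Subset V} → e ∈ₗ blockEdges ps → ∣ e ∣ ≡ r
    size e∈ with blockEdge-sound e∈
    ... | _ , p∈ , u , v , w , refl , refl , refl , refl =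
      trans (trans (∣++∣ u (v ++ w)) (cong (∣ u ∣ +_) (∣++∣ v w))) (All.lookup sized p∈)

  blockwise : {A : Set} → A → A → A → Fin V → A
  blockwise α β γ = Fun.replicate n₁ α Fun.++ (Fun.replicate n₂ β Fun.++ Fun.replicate n₃ γ)

  blockwise-ι₁ : {A : Set} (α β γ : A) (i : Fin n₁) → blockwise α β γ (ι₁ i) ≡ α
  blockwise-ι₁ α β γ i = lookup-++ˡ (Fun.replicate n₁ α) _ i

  blockwise-ι₂ : {A : Set} (α β γ : A) (i : Fin n₂) → blockwise α β γ (ι₂ i) ≡ β
  blockwise-ι₂ α β γ i =
    trans (lookup-++ʳ (Fun.replicate n₁ α) _ (i ↑ˡ n₃)) (lookup-++ˡ (Fun.replicate n₂ β) (Fun.replicate n₃ γ) i)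

  blockwise-ι₃ : {A : Set} (α β γ : A) (i : Fin n₃) → blockwise α β γ (ι₃ i) ≡ γ
  blockwise-ι₃ α β γ i =
    trans (lookup-++ʳ (Fun.replicate n₁ α) _ (n₂ ↑ʳ i)) (lookup-++ʳ (Fun.replicate n₂ β) (Fun.replicate n₃ γ) i)

  blockwise-edgeSum : {r : ℕ} (α β γ : Fin r) (u : Subset n₁) (v : Subset n₂) (w : Subset n₃) →
    edgeSum (blockwise α β γ) (u ++ (v ++ w)) ≡
      colourValue α * ∣ u ∣ + (colourValue β * ∣ v ∣ + colourValue γ * ∣ w ∣)
  blockwise-edgeSum α β γ u v w = begin
      edgeSum φ (u ++ (v ++ w))
    ≡⟨ edgeSum≡weight φ (u ++ (v ++ w)) ⟩
      weight value (u ++ (v ++ w))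
    ≡⟨ weight-++ value u (v ++ w) ⟩
      weight (value ∘ ι₁) u + weight (value ∘ (n₁ ↑ʳ_)) (v ++ w)
    ≡⟨ cong (weight (value ∘ ι₁) u +_) (weight-++ (value ∘ (n₁ ↑ʳ_)) v w) ⟩
      weight (value ∘ ι₁) u + (weight (value ∘ ι₂) v + weight (value ∘ ι₃) w)
    ≡⟨ cong₂ _+_ (constant (blockwise-ι₁ α β γ) u)
         (cong₂ _+_ (constant (blockwise-ι₂ α β γ) v) (constant (blockwise-ι₃ α β γ) w)) ⟩
      colourValue α * ∣ u ∣ + (colourValue β * ∣ v ∣ + colourValue γ * ∣ w ∣)
    ∎
    where
    open ≡-Reasoning
    φ = blockwise α β γ
    value = colourValue ∘ φ
    constant : {m : ℕ} {ι : Fin m → Fin V} {δ : Fin _} → (∀ i → φ (ι i) ≡ δ) →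
      (s : Subset m) → weight (value ∘ ι) s ≡ colourValue δ * ∣ s ∣
    constant {δ = δ} φι≡δ = weight-constant _ (colourValue δ) (cong colourValue ∘ φι≡δ)

  blockwise-odd : {r : ℕ} (ps : List Profile) (sized : All (Sized r) ps) (α β γ : Fin r) →
    All (OddProfile α β γ) ps → OddColorable (blockHypergraph r ps sized)
  blockwise-odd {r} ps sized α β γ odd = blockwise α β γ , λ e e∈ → sumOf (blockEdge-sound e∈)
    where
    sumOf : {e : Subset V} → ∃ (λ p → p ∈ₗ ps × Realises p e) →
      ∃ λ q → edgeSum (blockwise α β γ) e ≡ q * r + r / 2
    sumOf (_ , p∈ , u , v , w , refl , refl , refl , refl) with All.lookup odd p∈
    ... | q , sum≡ = q , trans (blockwise-edgeSum α β γ u v w) sum≡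

  blockwise-proper : {r : ℕ} (ps : List Profile) (sized : All (Sized r) ps) →
    All Spread ps → Chromatic (blockHypergraph r ps sized) 3
  blockwise-proper ps sized spread = c , λ e e∈ → split (blockEdge-sound e∈)
    where
    c : Fin V → Fin 3
    c = blockwise zero (suc zero) (suc (suc zero))
    apart : {a b : Fin V} {x y : Fin 3} → c a ≡ x → c b ≡ y → x ≢ y → c a ≢ c b
    apart ca≡x cb≡y x≢y ca≡cb = x≢y (trans (sym ca≡x) (trans ca≡cb cb≡y))
    split : {e : Subset V} → ∃ (λ p → p ∈ₗ ps × Realises p e) →
      ∃ λ (i : Fin V) → ∃ λ (j : Fin V) → i ∈ e × j ∈ e × c i ≢ c j
    split (_ , p∈ , u , v , w , refl , refl , refl , refl) with All.lookup spread p∈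
    ... | inj₁ (0<∣u∣ , 0<∣v∣) with nonempty u 0<∣u∣ | nonempty v 0<∣v∣
    ...   | i , i∈u | j , j∈v = ι₁ i , ι₂ j , ∈-↑ˡ (v ++ w) i∈u , ∈-↑ʳ u (∈-↑ˡ w j∈v) ,
      apart (blockwise-ι₁ _ _ _ i) (blockwise-ι₂ _ _ _ j) (λ ())
    split (_ , p∈ , u , v , w , refl , refl , refl , refl) | inj₂ (inj₁ (0<∣u∣ , 0<∣w∣))
      with nonempty u 0<∣u∣ | nonempty w 0<∣w∣
    ...   | i , i∈u | j , j∈w = ι₁ i , ι₃ j , ∈-↑ˡ (v ++ w) i∈u , ∈-↑ʳ u (∈-↑ʳ v j∈w) ,
      apart (blockwise-ι₁ _ _ _ i) (blockwise-ι₃ _ _ _ j) (λ ())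
    split (_ , p∈ , u , v , w , refl , refl , refl , refl) | inj₂ (inj₂ (0<∣v∣ , 0<∣w∣))
      with nonempty v 0<∣v∣ | nonempty w 0<∣w∣
    ...   | i , i∈v | j , j∈w = ι₂ i , ι₃ j , ∈-↑ʳ u (∈-↑ˡ w i∈v) , ∈-↑ʳ u (∈-↑ʳ v j∈w) ,
      apart (blockwise-ι₂ _ _ _ i) (blockwise-ι₃ _ _ _ j) (λ ())

  proper⇒¬large-mono : {r m : ℕ} {ps : List Profile} {sized : All (Sized r) ps}
    {c : Fin V → Fin m} {col : Fin m} {x y z : ℕ} →
    Proper (blockHypergraph r ps sized) c → (x , y , z) ∈ₗ ps →
    LargeMono (c ∘ ι₁) col x → LargeMono (c ∘ ι₂) col y → LargeMono (c ∘ ι₃) col z → False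
  proper⇒¬large-mono {r} {ps = ps} {sized} {c} proper p∈ large₁ large₂ large₃
    with largeMono-exact large₁ | largeMono-exact large₂ | largeMono-exact large₃
  ... | u , ∣u∣ , mu | v , ∣v∣ , mv | w , ∣w∣ , mw =
    proper⇒¬mono-edge {G = blockHypergraph r ps sized} proper (blockEdge-complete p∈ {u} {v} {w} ∣u∣ ∣v∣ ∣w∣)
      (mono-++ c u mu (mono-++ (c ∘ (n₁ ↑ʳ_)) v mv mw))

half-4k : (k : ℕ) → 4 * k / 2 ≡ 2 * k
half-4k k = trans (cong (_/ 2) (trans (*-assoc 2 2 k) (*-comm 2 (2 * k)))) (m*n/n≡m (2 * k) 2)

-- The edge sums 1·x + 2·y + 4k·z of the three profiles, written as q·4k + 2k.
profileSum₁ : (k : ℕ) → 1 * (2 * k) + (2 * 0 + 4 * k * (2 * k)) ≡ (2 * k) * (4 * k) + 2 * k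
profileSum₁ = solve-∀

profileSum₂ : (k : ℕ) → 1 * (2 * k) + (2 * (2 * k) + 4 * k * 0) ≡ 1 * (4 * k) + 2 * k
profileSum₂ = solve-∀

profileSum₃ : (k : ℕ) → 1 * 0 + (2 * k + 4 * k * (3 * k)) ≡ (3 * k) * (4 * k) + 2 * k
profileSum₃ = solve-∀

order-split : (k n : ℕ) → 16 * k ≤ n → ∃ λ M → 8 * k ≤ M × 4 * k + (4 * k + M) ≡ n
order-split k n 16k≤n = n ∸ 8 * k , m+n≤o⇒m≤o∸n (8 * k) 8k+8k≤n , (begin
    4 * k + (4 * k + (n ∸ 8 * k)) ≡⟨ sym (+-assoc (4 * k) (4 * k) (n ∸ 8 * k)) ⟩
    (4 * k + 4 * k) + (n ∸ 8 * k) ≡⟨ cong (_+ (n ∸ 8 * k)) (sym (*-distribʳ-+ k 4 4)) ⟩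
    8 * k + (n ∸ 8 * k)           ≡⟨ m+[n∸m]≡n (≤-trans (m≤m+n (8 * k) (8 * k)) 8k+8k≤n) ⟩
    n                             ∎)
  where
  open ≡-Reasoning
  8k+8k≤n : 8 * k + 8 * k ≤ n
  8k+8k≤n = subst (_≤ n) (*-distribʳ-+ k 8 8) 16k≤n

-- The construction: blocks Y, Z, X of sizes 4k, 4k, M ≥ 8k

module Construction (k′ M : ℕ) (8k≤M : 8 * suc k′ ≤ M) where

  k : ℕ
  k = suc k′

  open ThreeBlocks (4 * k) (4 * k) M

  profiles : List Profile
  profiles = (2 * k , 0 , 2 * k) ∷ₗ (2 * k , 2 * k , 0) ∷ₗ (0 , k , 3 * k) ∷ₗ []ₗ

  2k+2k≡4k : 2 * k + 2 * k ≡ 4 * k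
  2k+2k≡4k = sym (*-distribʳ-+ k 2 2)

  sized : All (Sized (4 * k)) profiles
  sized = 2k+2k≡4k All.∷ trans (cong (2 * k +_) (+-identityʳ (2 * k))) 2k+2k≡4k All.∷ refl All.∷ All.[]

  G : Hypergraph (4 * k) V
  G = blockHypergraph (4 * k) profiles sized

  1<4k : 1 < 4 * k
  1<4k = ≤-trans (s≤s (s≤s z≤n)) (*-monoʳ-≤ 4 (s≤s z≤n))

  one two top : Fin (4 * k)
  one = zero
  two = fromℕ< 1<4k
  top = fromℕ (k′ + 3 * k)

  value-two : colourValue two ≡ 2
  value-two = cong suc (toℕ-fromℕ< 1<4k)

  value-top : colourValue top ≡ 4 * k
  value-top = cong suc (toℕ-fromℕ (k′ + 3 * k))

  oddProfile : (x y z q : ℕ) → 1 * x + (2 * y + 4 * k * z) ≡ q * (4 * k) + 2 * k →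
    OddProfile one two top (x , y , z)
  oddProfile x y z q sum≡ = q , (begin
      1 * x + (colourValue two * y + colourValue top * z)
        ≡⟨ cong₂ (λ s t → 1 * x + (s * y + t * z)) value-two value-top ⟩
      1 * x + (2 * y + 4 * k * z)           ≡⟨ sum≡ ⟩
      q * (4 * k) + 2 * k                   ≡⟨ cong (q * (4 * k) +_) (sym (half-4k k)) ⟩
      q * (4 * k) + 4 * k / 2               ∎)
    where open ≡-Reasoning

  odd : OddColorable G
  odd = blockwise-odd profiles sized one two top
    (oddProfile (2 * k) 0 (2 * k) (2 * k) (profileSum₁ k) All.∷
     oddProfile (2 * k) (2 * k) 0 1 (profileSum₂ k) All.∷
     oddProfile 0 k (3 * k) (3 * k) (profileSum₃ k) All.∷ All.[])

  threeColourable : Chromatic G 3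
  threeColourable = blockwise-proper profiles sized
    (inj₂ (inj₁ (s≤s z≤n , s≤s z≤n)) All.∷ inj₁ (s≤s z≤n , s≤s z≤n) All.∷
     inj₂ (inj₂ (s≤s z≤n , s≤s z≤n)) All.∷ All.[])

  halfY : 2 * k + 2 * k ≤ suc (4 * k)
  halfY = ≤-trans (≤-reflexive 2k+2k≡4k) (n≤1+n (4 * k))

  halfX : 3 * k + 3 * k ≤ suc M
  halfX = ≤-trans (≤-reflexive (sym (*-distribʳ-+ k 3 3)))
            (≤-trans (*-monoˡ-≤ k (m≤m+n 6 2)) (≤-trans 8k≤M (n≤1+n M)))

  notTwoColourable : ¬ Chromatic G 2
  notTwoColourable (c , proper)
    with majority (c ∘ ι₁) halfY | majority (c ∘ ι₂) halfY | majority (c ∘ ι₃) halfX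
  ... | a , largeY | b , largeZ | d , largeX with pigeonhole a b d
  ... | inj₁ refl =
    proper⇒¬large-mono {sized = sized} {c} proper (Any.there (Any.here refl))
      largeY largeZ (largeMono-zero _ _)
  ... | inj₂ (inj₁ refl) =
    proper⇒¬large-mono {sized = sized} {c} proper (Any.here refl)
      largeY (largeMono-zero _ _) (largeMono-weaken (*-monoˡ-≤ k (n≤1+n 2)) largeX)
  ... | inj₂ (inj₂ refl) =
    proper⇒¬large-mono {sized = sized} {c} proper (Any.there (Any.there (Any.here refl)))
      (largeMono-zero _ _) (largeMono-weaken (m≤m+n k (k + 0)) largeZ) largeX

  result : Σ (Hypergraph (4 * k) V) (λ H → OddColorable H × ChromaticNumber H 3)
  result = G , odd , chromaticNumber-intro {G = G} threeColourable notTwoColourable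

proposition7 : (k n : ℕ) → 1 ≤ k → 16 * k ≤ n →
    Σ (Hypergraph (4 * k) n) (λ G → OddColorable G × ChromaticNumber G 3)
proposition7 (suc k′) n _ 16k≤n with order-split (suc k′) n 16k≤n
... | M , 8k≤M , refl = Construction.result k′ M 8k≤M
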